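{- Let $(W,S)$ be a simply-laced triangle-free Coxeter system and let ${\boldsymbol{\alpha}}$ be a link of rank $r\ge1$. Then for $1\le i\le r$, $\llbracket 2i-1,2i+1\rrbracket\in\operatorname{bs}({\boldsymbol{\alpha}})$ if and only if $\operatorname{supp}_{\llbracket 2i-1,2i+1\rrbracket}({\boldsymbol{\alpha}})=\operatorname{supp}_{\llbracket 2i\rrbracket}([{\boldsymbol{\alpha}}])$.
   Context: A Coxeter system $(W,S)$: finite $S$, $W=\langle S\mid (st)^{m(s,t)}=e\rangle$, $m(s,s)=1$, $m(s,t)\in\{2,3,\dots,\infty\}$ for $s\ne t$; simply laced: $m(s,t)\le3$; Coxeter graph $\Gamma$ on $S$ with edge $\{s,t\}$ iff $m(s,t)\ge3$; triangle free: no three-cycles in $\Gamma$. Reduced expression: minimal-length word for its element. Braid move: replace consecutive $sts$ by $tst$ with $m(s,t)=3$; braid class $[{\boldsymbol{\alpha}}]$: reduced expressions reachable from ${\boldsymbol{\alpha}}$ by braid moves. For ${\boldsymbol{\alpha}}=s_{x_1}\cdots s_{x_m}$: $\operatorname{supp}_{\llbracket i,j\rrbracket}({\boldsymbol{\alpha}})=\{s_{x_k}:i\le k\le j\}$, $\operatorname{supp}_{\llbracket i\rrbracket}=\operatorname{supp}_{\llbracket i,i\rrbracket}$, and $\operatorname{supp}_{\llbracket i,j\rrbracket}([{\boldsymbol{\alpha}}])=\bigcup_{{\boldsymbol{\beta}}\in[{\boldsymbol{\alpha}}]}\operatorname{supp}_{\llbracket i,j\rrbracket}({\boldsymbol{\beta}})$.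 $\llbracket i,i+2\rrbracket$ is a braid shadow of ${\boldsymbol{\alpha}}$ if $s_{x_i}=s_{x_{i+2}}$ and $m(s_{x_i},s_{x_{i+1}})=3$; $\operatorname{bs}({\boldsymbol{\alpha}})$ is the set of braid shadows, $\operatorname{bs}([{\boldsymbol{\alpha}}])$ the union over the braid class, $\operatorname{rank}({\boldsymbol{\alpha}})=|\operatorname{bs}([{\boldsymbol{\alpha}}])|$. A reduced expression with $m\ge1$ letters is a link if $m=1$ or $m$ is odd and $\operatorname{bs}([{\boldsymbol{\alpha}}])=\{\llbracket1,3\rrbracket,\llbracket3,5\rrbracket,\dots,\llbracket m-2,m\rrbracket\}$; a link of rank $r$ has $2r+1$ letters. -}

module Defs where

open import Data.Nat using (ℕ; zero; suc; _+_; _*_; _≤_)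
open import Data.Fin using (Fin)
open import Data.List using (List; []; _∷_; _++_; length)
open import Data.List.Membership.Propositional using (_∈_)
open import Data.List.Relation.Unary.Unique.Propositional using (Unique)
open import Data.Maybe using (Maybe; just; nothing)
open import Data.Product using (Σ; ∃; ∃-syntax; _×_)
open import Data.Sum using (_⊎_)
open import Relation.Nullary using (¬_)
open import Relation.Binary.PropositionalEquality using (_≡_; _≢_)
open import Relation.Binary.Construct.Closure.ReflexiveTransitive using (Star)
open import Function.Bundles using (_⇔_)

data ℕ∞ : Set where
  fin : ℕ → ℕ∞
  ∞   : ℕ∞

record CoxeterMatrix (n : ℕ) : Set where
  field
    m      : Fin n → Fin n → ℕ∞
    sym    : ∀ s t → m s t ≡ m t s
    diag   : ∀ s → m s s ≡ fin 1
    offdiag : ∀ s t → s ≢ t → (m s t ≡ ∞) ⊎ (Σ ℕ λ k → m s t ≡ fin (suc (suc k)))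
open CoxeterMatrix public

Word : ℕ → Set
Word n = List (Fin n)

pw : ∀ {n} → Fin n → Fin n → ℕ → Word n
pw s t zero    = []
pw s t (suc k) = s ∷ t ∷ pw s t k

-- Equality in W = ⟨ S | (st)^{m(s,t)} = e ⟩.  Since m(s,s)=1 gives s² = e,
-- every generator is invertible, so the monoid presented by the same
-- relations is exactly the group W; we use the congruence on words.
data _≈[_]_ {n : ℕ} : Word n → CoxeterMatrix n → Word n → Set where
  ≈-refl  : ∀ {M u} → u ≈[ M ] u
  ≈-sym   : ∀ {M u v} → u ≈[ M ] v → v ≈[ M ] u
  ≈-trans : ∀ {M u v w} → u ≈[ M ] v → v ≈[ M ] w → u ≈[ M ] w
  ≈-rel   : ∀ {M} u v s t k → m M s t ≡ fin k →
            (u ++ pw s t k ++ v) ≈[ M ] (u ++ v)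

Reduced : ∀ {n} → CoxeterMatrix n → Word n → Set
Reduced M α = ∀ β → β ≈[ M ] α → length α ≤ length β

SimplyLaced : ∀ {n} → CoxeterMatrix n → Set
SimplyLaced M = ∀ s t → s ≢ t → (m M s t ≡ fin 2) ⊎ (m M s t ≡ fin 3)

Edge : ∀ {n} → CoxeterMatrix n → Fin n → Fin n → Set
Edge M s t = s ≢ t × (m M s t ≡ ∞ ⊎ Σ ℕ λ k → m M s t ≡ fin (3 + k))

TriangleFree : ∀ {n} → CoxeterMatrix n → Set
TriangleFree M = ∀ a b c → ¬ (Edge M a b × Edge M b c × Edge M c a)

BraidMove : ∀ {n} → CoxeterMatrix n → Word n → Word n → Set
BraidMove {n} M α β =
  Σ (Word n) λ u → Σ (Word n) λ v → Σ (Fin n) λ s → Σ (Fin n) λ t →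
    m M s t ≡ fin 3 × α ≡ u ++ (s ∷ t ∷ s ∷ v) × β ≡ u ++ (t ∷ s ∷ t ∷ v)

InBraidClass : ∀ {n} → CoxeterMatrix n → Word n → Word n → Set
InBraidClass M α β = Star (BraidMove M) α β

-- 1-based letter lookup
at : ∀ {n} → Word n → ℕ → Maybe (Fin n)
at []      _             = nothing
at (x ∷ w) zero          = nothing
at (x ∷ w) (suc zero)    = just x
at (x ∷ w) (suc (suc k)) = at w (suc k)

BraidShadow : ∀ {n} → CoxeterMatrix n → Word n → ℕ → Set
BraidShadow M β i = ∃[ s ] ∃[ t ]
  (at β i ≡ just s × at β (suc i) ≡ just t × at β (2 + i) ≡ just s × m M s t ≡ fin 3)

InBsClass : ∀ {n} → CoxeterMatrix n → Word n → ℕ → Set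
InBsClass M α i = ∃[ β ] (InBraidClass M α β × BraidShadow M β i)

Supp : ∀ {n} → Word n → ℕ → ℕ → Fin n → Set
Supp β i j s = ∃[ k ] (i ≤ k × k ≤ j × at β k ≡ just s)

SuppClass : ∀ {n} → CoxeterMatrix n → Word n → ℕ → ℕ → Fin n → Set
SuppClass M α i j s = ∃[ β ] (InBraidClass M α β × Supp β i j s)

HasCard : (ℕ → Set) → ℕ → Set
HasCard P r = ∃[ xs ] (Unique xs × (∀ i → P i ⇔ (i ∈ xs)) × length xs ≡ r)

Rank : ∀ {n} → CoxeterMatrix n → Word n → ℕ → Set
Rank M α r = HasCard (InBsClass M α) r

IsLink : ∀ {n} → CoxeterMatrix n → Word n → Set
IsLink M α =
  Reduced M α × 1 ≤ length α ×
  ( length α ≡ 1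
  ⊎ (∃[ k ] length α ≡ suc (2 * k)) ×
    (∀ i → InBsClass M α i ⇔ (∃[ j ] (i ≡ suc (2 * j) × 2 + i ≤ length α))))

{-# OPTIONS --safe #-}
-- Since i ≤ rank, some word of the braid class has a braid shadow x y x at ⟦2i−1,2i+1⟧, and
-- in a link every word of the class has braid shadows only at odd positions. Hence a braid move
-- either misses the five letters at positions 2i−2, …, 2i+2, overlaps them in two letters at
-- one end, or is the move at ⟦2i−1,2i+1⟧ itself. Throughout the class the centre letter is x or
-- y and each inner letter is the other one of the pair, unless a braid on the neighbouring window
-- replaced it by a neighbour z of it, in which case the outer letter still remembers it;
-- triangle-freeness keeps such a z from ever braiding with the centre. So if α reads x y x there,
-- both supports are {x, y}; conversely, equal supports force the inner letters of α into {x, y},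
-- so α reads x y x.
module Submission where

open import Defs hiding (sym)
open import Data.Nat using (ℕ; zero; suc; _+_; _*_; _∸_; _≤_; _<_; z≤n; s≤s; s≤s⁻¹)
open import Data.Nat.Properties
open import Data.Fin using (Fin)
open import Data.List using (List; []; _∷_; _++_; length; filter; applyUpTo)
open import Data.List.Properties using (filter-all; length-++; length-applyUpTo)
open import Data.List.Membership.Propositional using (_∈_)
open import Data.List.Membership.Propositional.Properties using (∈-filter⁻; ∈-applyUpTo⁺)
open import Data.List.Relation.Binary.Subset.Propositional using (_⊆_)
open import Data.List.Relation.Unary.Any using (here; there)
open import Data.List.Relation.Unary.All as All using ()
open import Data.List.Relation.Unary.AllPairs using (_∷_)
open import Data.List.Relation.Unary.Unique.Propositional using (Unique)
open import Data.List.Relation.Unary.Unique.Propositional.Properties using (filter⁺)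
open import Data.Maybe using (Maybe; just)
open import Data.Maybe.Properties using (just-injective)
open import Data.Product using (∃-syntax; _×_; _,_)
open import Data.Sum using (_⊎_; inj₁; inj₂; swap)
import Data.Sum as Sum
open import Data.Empty using (⊥-elim)
open import Relation.Nullary using (¬_; ¬?; yes; no; contradiction)
open import Relation.Binary.Definitions using (DecidableEquality)
open import Relation.Binary.PropositionalEquality
  using (_≡_; _≢_; refl; sym; trans; cong; subst; subst₂; module ≡-Reasoning)
open import Relation.Binary.Construct.Closure.ReflexiveTransitive using (ε; _◅_; _◅◅_; reverse)
open import Function.Base using (_∘_)
open import Function.Bundles using (_⇔_; Equivalence; mk⇔)

module _ {a} {A : Set a} (_≟_ : DecidableEquality A) where

  length≤1+length-filter≢ : ∀ y {xs : List A} → Unique xs →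
    length xs ≤ suc (length (filter (λ z → ¬? (z ≟ y)) xs))
  length≤1+length-filter≢ y {[]} _ = z≤n
  length≤1+length-filter≢ y {x ∷ xs} (x∉xs ∷ u) with x ≟ y
  ... | yes refl rewrite filter-all (λ z → ¬? (z ≟ x)) (All.map (λ x≢z z≡x → x≢z (sym z≡x)) x∉xs) = ≤-refl
  ... | no _ = s≤s (length≤1+length-filter≢ y u)

  unique-⊆⇒length≤ : ∀ {xs ys : List A} → Unique xs → xs ⊆ ys → length xs ≤ length ys
  unique-⊆⇒length≤ {[]}    {_}      _ _    = z≤n
  unique-⊆⇒length≤ {_ ∷ _} {[]}     _ xs⊆ with xs⊆ (here refl)
  ... | ()
  unique-⊆⇒length≤ {xs}    {y ∷ ys} u xs⊆ =
    ≤-trans (length≤1+length-filter≢ y u) (s≤s (unique-⊆⇒length≤ (filter⁺ (λ z → ¬? (z ≟ y)) u) ⊆ys))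
    where
    ⊆ys : filter (λ z → ¬? (z ≟ y)) xs ⊆ ys
    ⊆ys z∈ with ∈-filter⁻ (λ z → ¬? (z ≟ y)) z∈
    ... | z∈xs , z≢y with xs⊆ z∈xs
    ... | here z≡y = contradiction z≡y z≢y
    ... | there z∈ys = z∈ys

hasCard-≤ : ∀ {P : ℕ → Set} {r} (ys : List ℕ) → HasCard P r → (∀ {q} → P q → q ∈ ys) → r ≤ length ys
hasCard-≤ ys (xs , u , P⇔ , refl) P⊆ = unique-⊆⇒length≤ _≟_ u (λ q∈ → P⊆ (Equivalence.from (P⇔ _) q∈))

m≤n≤2+m⇒n≡m∨1+m∨2+m : ∀ {m n} → m ≤ n → n ≤ 2 + m → n ≡ m ⊎ n ≡ 1 + m ⊎ n ≡ 2 + m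
m≤n≤2+m⇒n≡m∨1+m∨2+m {zero}  {zero}                z≤n _               = inj₁ refl
m≤n≤2+m⇒n≡m∨1+m∨2+m {zero}  {suc zero}            z≤n _               = inj₂ (inj₁ refl)
m≤n≤2+m⇒n≡m∨1+m∨2+m {zero}  {suc (suc zero)}      z≤n _               = inj₂ (inj₂ refl)
m≤n≤2+m⇒n≡m∨1+m∨2+m {zero}  {suc (suc (suc _))}   z≤n (s≤s (s≤s ()))
m≤n≤2+m⇒n≡m∨1+m∨2+m {suc m} {suc n}               (s≤s m≤n) (s≤s n≤) =
  Sum.map (cong suc) (Sum.map (cong suc) (cong suc)) (m≤n≤2+m⇒n≡m∨1+m∨2+m m≤n n≤)

3+2c≤1+2k⇔c<k : ∀ {c k} → 3 + 2 * c ≤ suc (2 * k) ⇔ c < k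
3+2c≤1+2k⇔c<k {c} {k} = mk⇔
  (λ 3+2c≤ → *-cancelˡ-≤ 2 (subst (_≤ 2 * k) (sym (*-suc 2 c)) (s≤s⁻¹ 3+2c≤)))
  (λ c<k → s≤s (subst (_≤ 2 * k) (*-suc 2 c) (*-monoʳ-≤ 2 c<k)))

at-++ˡ : ∀ {n} (u w : Word n) {k} → k ≤ length u → at (u ++ w) k ≡ at u k
at-++ˡ []          []      {zero}        _         = refl
at-++ˡ []          (_ ∷ _) {zero}        _         = refl
at-++ˡ (_ ∷ _)     _       {zero}        _         = refl
at-++ˡ (_ ∷ _)     _       {suc zero}    _         = refl
at-++ˡ (_ ∷ y ∷ u) w       {suc (suc k)} (s≤s k≤) = at-++ˡ (y ∷ u) w k≤
at-++ˡ (_ ∷ [])    _       {suc (suc _)} (s≤s ())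

at-++ʳ : ∀ {n} (u w : Word n) m → at (u ++ w) (suc m + length u) ≡ at w (suc m)
at-++ʳ []      w m = cong (at w) (+-identityʳ (suc m))
at-++ʳ (_ ∷ u) w m rewrite +-suc m (length u) = at-++ʳ u w m

at-just⇒≤length : ∀ {n} (w : Word n) k {s} → at w k ≡ just s → k ≤ length w
at-just⇒≤length []      _             ()
at-just⇒≤length (_ ∷ _) zero          _ = z≤n
at-just⇒≤length (_ ∷ _) (suc zero)    _ = s≤s z≤n
at-just⇒≤length (_ ∷ w) (suc (suc k)) e = s≤s (at-just⇒≤length w (suc k) e)

at-++-outside : ∀ {n} (u w w′ v : Word n) {k} → length w ≡ length w′ →
  k ≤ length u ⊎ length w + length u < k → at (u ++ w ++ v) k ≡ at (u ++ w′ ++ v) k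
at-++-outside u w w′ v _ (inj₁ k≤) = trans (at-++ˡ u _ k≤) (sym (at-++ˡ u _ k≤))
at-++-outside u w w′ v {k} |w|≡ (inj₂ <k) with m≤n⇒∃[o]m+o≡n <k
... | m , refl = begin
  at (u ++ w ++ v) (suc (length w + length u + m))   ≡⟨ beyond w ⟩
  at v (suc m)                                       ≡⟨ sym (beyond w′) ⟩
  at (u ++ w′ ++ v) (suc (length w′ + length u + m))
    ≡⟨ cong (λ l → at (u ++ w′ ++ v) (suc (l + length u + m))) (sym |w|≡) ⟩
  at (u ++ w′ ++ v) (suc (length w + length u + m))  ∎
  where
  open ≡-Reasoning
  beyond : ∀ x → at (u ++ x ++ v) (suc (length x + length u + m)) ≡ at v (suc m)
  beyond x = begin
    at (u ++ x ++ v) (suc (length x + length u + m))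
      ≡⟨ cong (at (u ++ x ++ v) ∘ suc) (+-comm (length x + length u) m) ⟩
    at (u ++ x ++ v) (suc m + (length x + length u))
      ≡⟨ cong (at (u ++ x ++ v) ∘ suc) (sym (+-assoc m (length x) (length u))) ⟩
    at (u ++ x ++ v) (suc (m + length x) + length u)
      ≡⟨ at-++ʳ u (x ++ v) (m + length x) ⟩
    at (x ++ v) (suc m + length x)
      ≡⟨ at-++ʳ x v m ⟩
    at v (suc m)
      ∎

record Window (A : Set) : Set where
  constructor ⟨_,_,_,_,_⟩
  field outerˡ innerˡ centre innerʳ outerʳ : A
open Window

⟨⟩-cong : ∀ {A : Set} {a a′ b b′ c c′ d d′ e e′ : A} → a ≡ a′ → b ≡ b′ → c ≡ c′ → d ≡ d′ → e ≡ e′ →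
  ⟨ a , b , c , d , e ⟩ ≡ ⟨ a′ , b′ , c′ , d′ , e′ ⟩
⟨⟩-cong refl refl refl refl refl = refl

-- Positions are 1-based and at β 0 ≡ nothing, so the window at p = 0 has no outer-left letter.
window : ∀ {n} → Word n → ℕ → Window (Maybe (Fin n))
window β p = ⟨ at β p , at β (1 + p) , at β (2 + p) , at β (3 + p) , at β (4 + p) ⟩

window-cong : ∀ {n} (β γ : Word n) {p} → (∀ k → p ≤ k → k ≤ 4 + p → at β k ≡ at γ k) →
  window β p ≡ window γ p
window-cong _ _ {p} at≡ = ⟨⟩-cong
  (at≡ p ≤-refl (m≤n+m p 4))
  (at≡ (1 + p) (m≤n+m p 1) (+-monoˡ-≤ p (s≤s z≤n)))
  (at≡ (2 + p) (m≤n+m p 2) (+-monoˡ-≤ p (s≤s (s≤s z≤n))))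
  (at≡ (3 + p) (m≤n+m p 3) (+-monoˡ-≤ p (s≤s (s≤s (s≤s z≤n))))) (at≡ (4 + p) (m≤n+m p 4) ≤-refl)

window-++ : ∀ {n} (u w : Word n) →
  window (u ++ w) (length u) ≡ ⟨ at u (length u) , at w 1 , at w 2 , at w 3 , at w 4 ⟩
window-++ u w = ⟨⟩-cong (at-++ˡ u w ≤-refl) (at-++ʳ u w 0) (at-++ʳ u w 1) (at-++ʳ u w 2) (at-++ʳ u w 3)

window-++ʳ : ∀ {n} (u w : Word n) k → window (u ++ w) (suc k + length u) ≡ window w (suc k)
window-++ʳ u w k =
  ⟨⟩-cong (at-++ʳ u w k) (at-++ʳ u w (1 + k)) (at-++ʳ u w (2 + k)) (at-++ʳ u w (3 + k)) (at-++ʳ u w (4 + k))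

window-++-straddle : ∀ {n} (u w : Word n) {p} → length u ≡ 2 + p →
  window (u ++ w) p ≡ ⟨ at u p , at u (1 + p) , at u (2 + p) , at w 1 , at w 2 ⟩
window-++-straddle u w {p} |u|≡ = ⟨⟩-cong
  (at-++ˡ u w (≤-trans (m≤n+m p 2) ≤|u|))
  (at-++ˡ u w (≤-trans (n≤1+n (1 + p)) ≤|u|))
  (at-++ˡ u w ≤|u|) (subst (λ l → at (u ++ w) (suc l) ≡ at w 1) |u|≡ (at-++ʳ u w 0))
  (subst (λ l → at (u ++ w) (2 + l) ≡ at w 2) |u|≡ (at-++ʳ u w 1))
  where
  ≤|u| : 2 + p ≤ length u
  ≤|u| = ≤-reflexive (sym |u|≡)

window-braid-outside : ∀ {n} (u v : Word n) S T {p} →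
  (∀ {k} → p ≤ k → k ≤ 4 + p → k ≤ length u ⊎ 3 + length u < k) →
  window (u ++ S ∷ T ∷ S ∷ v) p ≡ window (u ++ T ∷ S ∷ T ∷ v) p
window-braid-outside u v S T outside =
  window-cong (u ++ S ∷ T ∷ S ∷ v) (u ++ T ∷ S ∷ T ∷ v) λ _ p≤k k≤ →
    at-++-outside u (S ∷ T ∷ S ∷ []) (T ∷ S ∷ T ∷ []) v refl (outside p≤k k≤)

-- How a braid move on positions a+1, a+2, a+3 sits relative to the window of positions p, …, p+4.
data Placement (a p : ℕ) : Set where
  disjointˡ : a + 4 ≤ p → Placement a p
  overlapˡ  : p ≡ 2 + a → Placement a p
  aligned   : p ≡ a → Placement a p
  overlapʳ  : a ≡ 2 + p → Placement a p
  disjointʳ : p + 4 ≤ a → Placement a p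

placement-+2 : ∀ {a p} → Placement a p → Placement (2 + a) (2 + p)
placement-+2 (disjointˡ a+4≤p) = disjointˡ (s≤s (s≤s a+4≤p))
placement-+2 (overlapˡ refl)   = overlapˡ refl
placement-+2 (aligned refl)    = aligned refl
placement-+2 (overlapʳ refl)   = overlapʳ refl
placement-+2 (disjointʳ p+4≤a) = disjointʳ (s≤s (s≤s p+4≤a))

placement-even : ∀ c j → Placement (2 * c) (2 * j)
placement-even zero          zero          = aligned refl
placement-even zero          (suc zero)    = overlapˡ refl
placement-even zero          (suc (suc j)) = disjointˡ (*-monoʳ-≤ 2 (m≤m+n 2 j))
placement-even (suc zero)    zero          = overlapʳ refl
placement-even (suc (suc c)) zero          = disjointʳ (*-monoʳ-≤ 2 (m≤m+n 2 c))
placement-even (suc c)       (suc j)       =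
  subst₂ Placement (sym (*-suc 2 c)) (sym (*-suc 2 j)) (placement-+2 (placement-even c j))

module _ {n} (M : CoxeterMatrix n) where

  Letter : Set
  Letter = Maybe (Fin n)

  _∼_ : Fin n → Fin n → Set
  s ∼ t = m M s t ≡ fin 3

  ∼-sym : ∀ {s t} → s ∼ t → t ∼ s
  ∼-sym {s} {t} s∼t = trans (CoxeterMatrix.sym M t s) s∼t

  ∼⇒Edge : ∀ {s t} → s ∼ t → Edge M s t
  ∼⇒Edge {s} s∼t = s≢t , inj₂ (0 , s∼t)
    where
    s≢t : s ≢ _
    s≢t refl with trans (sym s∼t) (diag M s)
    ... | ()

  Braid₃ : Letter → Letter → Letter → Set
  Braid₃ l c r = ∃[ s ] ∃[ t ] (l ≡ just s × c ≡ just t × r ≡ just s × s ∼ t)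

  Flank : Fin n → Fin n → Letter → Letter → Set
  Flank a b outer inner = inner ≡ just a ⊎ ∃[ z ] (inner ≡ just z × z ≢ b × a ∼ z × outer ≡ just a)

  Centred : Fin n → Fin n → Window Letter → Set
  Centred a b w = centre w ≡ just b × Flank a b (outerˡ w) (innerˡ w) × Flank a b (outerʳ w) (innerʳ w)

  Pinned : Fin n → Fin n → Window Letter → Set
  Pinned x y w = Centred x y w ⊎ Centred y x w

  flank-braid : ∀ {a b S T} → S ∼ T → T ≢ b → Flank a b (just T) (just S) → Flank a b (just S) (just T)
  flank-braid {T = T} S∼T T≢b (inj₁ refl)                    = inj₂ (T , refl , T≢b , S∼T , refl)
  flank-braid         _   _   (inj₂ (_ , refl , _ , _ , refl)) = inj₁ refl

  centred-braidˡ : ∀ {a b S T c i o} → S ∼ T → ¬ Braid₃ (just T) (just S) c →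
    Centred a b ⟨ just T , just S , c , i , o ⟩ → Centred a b ⟨ just S , just T , c , i , o ⟩
  centred-braidˡ {S = S} {T} S∼T ¬braid (c≡b , fˡ , fʳ) = c≡b , flank-braid S∼T T≢b fˡ , fʳ
    where
    T≢b : T ≢ _
    T≢b refl = ¬braid (T , S , refl , refl , c≡b , ∼-sym S∼T)

  centred-braidʳ : ∀ {a b S T c i o} → S ∼ T → ¬ Braid₃ c (just S) (just T) →
    Centred a b ⟨ o , i , c , just S , just T ⟩ → Centred a b ⟨ o , i , c , just T , just S ⟩
  centred-braidʳ {S = S} {T} S∼T ¬braid (c≡b , fˡ , fʳ) = c≡b , fˡ , flank-braid S∼T T≢b fʳ
    where
    T≢b : T ≢ _
    T≢b refl = ¬braid (T , S , c≡b , refl , refl , ∼-sym S∼T)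

  -- A neighbour of b flanking the centre b must be a itself: otherwise a, b, z form a triangle.
  flank-centre : TriangleFree M → ∀ {a b S o} → a ∼ b → S ∼ b → Flank a b o (just S) → S ≡ a
  flank-centre _  _   _   (inj₁ refl)                   = refl
  flank-centre tf a∼b S∼b (inj₂ (_ , refl , _ , a∼S , _)) =
    ⊥-elim (tf _ _ _ (∼⇒Edge a∼b , ∼⇒Edge (∼-sym S∼b) , ∼⇒Edge (∼-sym a∼S)))

  centred-braidᶜ : TriangleFree M → ∀ {a b S T o o′} → a ∼ b → S ∼ T →
    Centred a b ⟨ o , just S , just T , just S , o′ ⟩ → Centred b a ⟨ o , just T , just S , just T , o′ ⟩
  centred-braidᶜ tf a∼b S∼T (refl , fˡ , _) with flank-centre tf a∼b S∼T fˡ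
  ... | refl = refl , inj₁ refl , inj₁ refl

  pinned-braidˡ : ∀ {x y S T c i o} → S ∼ T → ¬ Braid₃ (just T) (just S) c →
    Pinned x y ⟨ just T , just S , c , i , o ⟩ → Pinned x y ⟨ just S , just T , c , i , o ⟩
  pinned-braidˡ S∼T ¬braid = Sum.map (centred-braidˡ S∼T ¬braid) (centred-braidˡ S∼T ¬braid)

  pinned-braidʳ : ∀ {x y S T c i o} → S ∼ T → ¬ Braid₃ c (just S) (just T) →
    Pinned x y ⟨ o , i , c , just S , just T ⟩ → Pinned x y ⟨ o , i , c , just T , just S ⟩
  pinned-braidʳ S∼T ¬braid = Sum.map (centred-braidʳ S∼T ¬braid) (centred-braidʳ S∼T ¬braid)

  pinned-braidᶜ : TriangleFree M → ∀ {x y S T o o′} → x ∼ y → S ∼ T →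
    Pinned x y ⟨ o , just S , just T , just S , o′ ⟩ → Pinned x y ⟨ o , just T , just S , just T , o′ ⟩
  pinned-braidᶜ tf x∼y S∼T (inj₁ c) = inj₂ (centred-braidᶜ tf x∼y S∼T c)
  pinned-braidᶜ tf x∼y S∼T (inj₂ c) = inj₁ (centred-braidᶜ tf (∼-sym x∼y) S∼T c)

  pinned⇒centre : ∀ {x y w} → Pinned x y w → centre w ≡ just x ⊎ centre w ≡ just y
  pinned⇒centre (inj₁ (c≡y , _)) = inj₂ c≡y
  pinned⇒centre (inj₂ (c≡x , _)) = inj₁ c≡x

  _∈₂_ : Letter → Fin n × Fin n → Set
  l ∈₂ (x , y) = ∀ z → l ≡ just z → z ≡ x ⊎ z ≡ y

  flank-∈₂ : ∀ {a b o i} → Flank a b o i → i ∈₂ (a , b) → i ≡ just a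
  flank-∈₂ (inj₁ i≡a) _ = i≡a
  flank-∈₂ (inj₂ (z , i≡z , z≢b , _)) i∈ with i∈ z i≡z
  ... | inj₁ refl = i≡z
  ... | inj₂ z≡b  = contradiction z≡b z≢b

  pinned⇒braid : ∀ {x y w} → x ∼ y → Pinned x y w → innerˡ w ∈₂ (x , y) → innerʳ w ∈₂ (x , y) →
    Braid₃ (innerˡ w) (centre w) (innerʳ w)
  pinned⇒braid {x} {y} x∼y (inj₁ (c≡y , fˡ , fʳ)) ∈ˡ ∈ʳ =
    x , y , flank-∈₂ fˡ ∈ˡ , c≡y , flank-∈₂ fʳ ∈ʳ , x∼y
  pinned⇒braid {x} {y} x∼y (inj₂ (c≡x , fˡ , fʳ)) ∈ˡ ∈ʳ =
    y , x , flank-∈₂ fˡ (λ z e → swap (∈ˡ z e)) , c≡x , flank-∈₂ fʳ (λ z e → swap (∈ʳ z e)) , ∼-sym x∼y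

  LeftBraid RightBraid : Window Letter → Set
  LeftBraid  w = Braid₃ (outerˡ w) (innerˡ w) (centre w)
  RightBraid w = Braid₃ (centre w) (innerʳ w) (outerʳ w)

  pinned-via : ∀ {x y w w′ v v′} → w ≡ v → w′ ≡ v′ →
    (Pinned x y v → Pinned x y v′) → Pinned x y w → Pinned x y w′
  pinned-via refl refl f = f

  pinned-braid : TriangleFree M → ∀ {x y S T p} (u v : Word n) → x ∼ y → S ∼ T → Placement (length u) p →
    ¬ BraidShadow M (u ++ S ∷ T ∷ S ∷ v) p → ¬ BraidShadow M (u ++ S ∷ T ∷ S ∷ v) (2 + p) →
    Pinned x y (window (u ++ S ∷ T ∷ S ∷ v) p) → Pinned x y (window (u ++ T ∷ S ∷ T ∷ v) p)
  pinned-braid _ {x} {y} {S} {T} u v _ _ (disjointˡ |u|+4≤p) _ _ =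
    subst (Pinned x y) (window-braid-outside u v S T λ p≤k _ →
      inj₂ (≤-trans (≤-reflexive (+-comm 4 (length u))) (≤-trans |u|+4≤p p≤k)))
  pinned-braid _ {x} {y} {S} {T} {p} u v _ _ (disjointʳ p+4≤|u|) _ _ =
    subst (Pinned x y) (window-braid-outside u v S T λ _ k≤ →
      inj₁ (≤-trans k≤ (≤-trans (≤-reflexive (+-comm 4 p)) p+4≤|u|)))
  pinned-braid _ u v _ S∼T (overlapˡ refl) ¬sh _ =
    pinned-via (window-++ʳ u _ 1) (window-++ʳ u _ 1)
      (pinned-braidˡ S∼T (¬sh ∘ subst LeftBraid (sym (window-++ʳ u _ 1))))
  pinned-braid tf u v x∼y S∼T (aligned refl) _ _ =
    pinned-via (window-++ u _) (window-++ u _) (pinned-braidᶜ tf x∼y S∼T)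
  pinned-braid _ u v _ S∼T (overlapʳ |u|≡) _ ¬sh =
    pinned-via (window-++-straddle u _ |u|≡) (window-++-straddle u _ |u|≡)
      (pinned-braidʳ S∼T (¬sh ∘ subst RightBraid (sym (window-++-straddle u _ |u|≡))))

  OddShadows : Word n → Set
  OddShadows β = ∀ q → BraidShadow M β q → ∃[ c ] q ≡ suc (2 * c)

  oddShadows⇒¬even : ∀ {β} → OddShadows β → ∀ j → ¬ BraidShadow M β (2 * j)
  oddShadows⇒¬even odd j sh with odd _ sh
  ... | c , 2j≡ = even≢odd j c 2j≡

  braidMove-shadow : ∀ (u v : Word n) {S T} → S ∼ T → BraidShadow M (u ++ S ∷ T ∷ S ∷ v) (suc (length u))
  braidMove-shadow u v S∼T = _ , _ , at-++ʳ u _ 0 , at-++ʳ u _ 1 , at-++ʳ u _ 2 , S∼T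

  pinned-braidMove : TriangleFree M → ∀ {x y β γ} j → x ∼ y → OddShadows β → BraidMove M β γ →
    Pinned x y (window β (2 * j)) → Pinned x y (window γ (2 * j))
  pinned-braidMove tf j x∼y odd (u , v , S , T , S∼T , refl , refl) with odd _ (braidMove-shadow u v S∼T)
  ... | c , 1+|u|≡ = pinned-braid tf u v x∼y S∼T placement (oddShadows⇒¬even {β} odd j) ¬shadow
    where
    placement : Placement (length u) (2 * j)
    placement = subst (λ a → Placement a (2 * j)) (sym (suc-injective 1+|u|≡)) (placement-even c j)
    β : Word n
    β = u ++ S ∷ T ∷ S ∷ v
    ¬shadow : ¬ BraidShadow M β (2 + 2 * j)
    ¬shadow = subst (¬_ ∘ BraidShadow M β) (*-suc 2 j) (oddShadows⇒¬even {β} odd (suc j))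

  pinned-braidClass : TriangleFree M → ∀ {x y β γ} j → x ∼ y → (∀ δ → InBraidClass M β δ → OddShadows δ) →
    InBraidClass M β γ → Pinned x y (window β (2 * j)) → Pinned x y (window γ (2 * j))
  pinned-braidClass tf j x∼y odd ε         P = P
  pinned-braidClass tf j x∼y odd (mv ◅ mvs) P =
    pinned-braidClass tf j x∼y (λ δ → odd δ ∘ (mv ◅_)) mvs (pinned-braidMove tf j x∼y (odd _ ε) mv P)

  braidMove-sym : ∀ {β γ} → BraidMove M β γ → BraidMove M γ β
  braidMove-sym (u , v , S , T , S∼T , refl , refl) = u , v , T , S , ∼-sym S∼T , refl , refl

  braidMove-length : ∀ {β γ} → BraidMove M β γ → length β ≡ length γ
  braidMove-length (u , _ , _ , _ , _ , refl , refl) = trans (length-++ u) (sym (length-++ u))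

  braidClass-length : ∀ {β γ} → InBraidClass M β γ → length β ≡ length γ
  braidClass-length ε          = refl
  braidClass-length (mv ◅ mvs) = trans (braidMove-length mv) (braidClass-length mvs)

  inBsClass⇒≤length : ∀ {α q} → InBsClass M α q → 2 + q ≤ length α
  inBsClass⇒≤length (β , αβ , (_ , _ , _ , _ , at≡ , _)) =
    ≤-trans (at-just⇒≤length β _ at≡) (≤-reflexive (sym (braidClass-length αβ)))

  shadow⇒braidMove : ∀ α {x y} p → at α (1 + p) ≡ just x → at α (2 + p) ≡ just y → at α (3 + p) ≡ just x →
    x ∼ y → ∃[ γ ] (BraidMove M α γ × at γ (2 + p) ≡ just x)
  shadow⇒braidMove (_ ∷ _ ∷ _ ∷ v) zero refl refl refl x∼y = _ , ([] , v , _ , _ , x∼y , refl , refl) , refl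
  shadow⇒braidMove (a ∷ α) (suc p) e₁ e₂ e₃ x∼y with shadow⇒braidMove α p e₁ e₂ e₃ x∼y
  ... | _ , (u , v , s , t , s∼t , refl , refl) , e = _ , (a ∷ u , v , s , t , s∼t , refl , refl) , e
  shadow⇒braidMove []                zero    () _  _  _
  shadow⇒braidMove (_ ∷ [])          zero    _  () _  _
  shadow⇒braidMove (_ ∷ _ ∷ [])      zero    _  _  () _
  shadow⇒braidMove []                (suc _) () _  _  _

  supp-point⁻ : ∀ (β : Word n) {k s} → Supp β k k s → at β k ≡ just s
  supp-point⁻ _ (_ , k≤ , ≤k , at≡) with ≤-antisym k≤ ≤k
  ... | refl = at≡

  supp-three⁻ : ∀ (β : Word n) {p s} → Supp β p (2 + p) s →
    at β p ≡ just s ⊎ at β (1 + p) ≡ just s ⊎ at β (2 + p) ≡ just s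
  supp-three⁻ _ (_ , p≤ , ≤2+p , at≡) with m≤n≤2+m⇒n≡m∨1+m∨2+m p≤ ≤2+p
  ... | inj₁ refl          = inj₁ at≡
  ... | inj₂ (inj₁ refl)   = inj₂ (inj₁ at≡)
  ... | inj₂ (inj₂ refl)   = inj₂ (inj₂ at≡)

  supp-point⁺ : ∀ (β : Word n) {k s} → at β k ≡ just s → Supp β k k s
  supp-point⁺ _ at≡ = _ , ≤-refl , ≤-refl , at≡

  module _ (tf : TriangleFree M) {α : Word n} (odd : ∀ β → InBraidClass M α β → OddShadows β) (j : ℕ) where

    class-pinned : ∀ β {x y} → InBraidClass M α β →
      at β (1 + 2 * j) ≡ just x → at β (2 + 2 * j) ≡ just y → at β (3 + 2 * j) ≡ just x → x ∼ y →
      ∀ γ → InBraidClass M α γ → Pinned x y (window γ (2 * j))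
    class-pinned _ αβ e₁ e₂ e₃ x∼y γ αγ =
      pinned-braidClass tf j x∼y (λ δ βδ → odd δ (αβ ◅◅ βδ)) (reverse braidMove-sym αβ ◅◅ αγ)
        (inj₁ (e₂ , inj₁ e₁ , inj₁ e₃))

    suppClass-centre : ∀ {x y} → (∀ γ → InBraidClass M α γ → Pinned x y (window γ (2 * j))) →
      ∀ {s} → SuppClass M α (2 + 2 * j) (2 + 2 * j) s → s ≡ x ⊎ s ≡ y
    suppClass-centre pinned (γ , αγ , s∈) with pinned⇒centre (pinned γ αγ)
    ... | inj₁ centre≡x = inj₁ (just-injective (trans (sym (supp-point⁻ γ s∈)) centre≡x))
    ... | inj₂ centre≡y = inj₂ (just-injective (trans (sym (supp-point⁻ γ s∈)) centre≡y))

    shadow⇒supp⇔ : BraidShadow M α (suc (2 * j)) →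
      ∀ s → Supp α (suc (2 * j)) (3 + 2 * j) s ⇔ SuppClass M α (2 + 2 * j) (2 + 2 * j) s
    shadow⇒supp⇔ (x , y , e₁ , e₂ , e₃ , x∼y) s = mk⇔ to from
      where
      supp⊆ : Supp α (suc (2 * j)) (3 + 2 * j) s → s ≡ x ⊎ s ≡ y
      supp⊆ s∈ with supp-three⁻ α s∈
      ... | inj₁ e₁′         = inj₁ (just-injective (trans (sym e₁′) e₁))
      ... | inj₂ (inj₁ e₂′)  = inj₂ (just-injective (trans (sym e₂′) e₂))
      ... | inj₂ (inj₂ e₃′)  = inj₁ (just-injective (trans (sym e₃′) e₃))

      to : Supp α (suc (2 * j)) (3 + 2 * j) s → SuppClass M α (2 + 2 * j) (2 + 2 * j) s
      to s∈ with supp⊆ s∈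
      ... | inj₁ refl with shadow⇒braidMove α (2 * j) e₁ e₂ e₃ x∼y
      ...   | γ , mv , centre≡x = γ , mv ◅ ε , supp-point⁺ γ centre≡x
      to s∈ | inj₂ refl = α , ε , supp-point⁺ α e₂

      from : SuppClass M α (2 + 2 * j) (2 + 2 * j) s → Supp α (suc (2 * j)) (3 + 2 * j) s
      from s∈ with suppClass-centre (class-pinned α ε e₁ e₂ e₃ x∼y) s∈
      ... | inj₁ refl = _ , ≤-refl , m≤n+m _ 2 , e₁
      ... | inj₂ refl = _ , n≤1+n _ , n≤1+n _ , e₂

    supp⇔⇒shadow : InBsClass M α (suc (2 * j)) →
      (∀ s → Supp α (suc (2 * j)) (3 + 2 * j) s ⇔ SuppClass M α (2 + 2 * j) (2 + 2 * j) s) →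
      BraidShadow M α (suc (2 * j))
    supp⇔⇒shadow (β , αβ , (x , y , e₁ , e₂ , e₃ , x∼y)) supp⇔ =
      pinned⇒braid x∼y (pinned α ε) (letter∈ ≤-refl (m≤n+m _ 2)) (letter∈ (m≤n+m _ 2) ≤-refl)
      where
      pinned : ∀ γ → InBraidClass M α γ → Pinned x y (window γ (2 * j))
      pinned = class-pinned β αβ e₁ e₂ e₃ x∼y
      letter∈ : ∀ {k} → suc (2 * j) ≤ k → k ≤ 3 + 2 * j → at α k ∈₂ (x , y)
      letter∈ ≤k k≤ z at≡ = suppClass-centre pinned (Equivalence.to (supp⇔ z) (_ , ≤k , k≤ , at≡))

    braidShadow⇔supp⇔ : InBsClass M α (suc (2 * j)) → BraidShadow M α (suc (2 * j)) ⇔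
      (∀ s → Supp α (suc (2 * j)) (3 + 2 * j) s ⇔ SuppClass M α (2 + 2 * j) (2 + 2 * j) s)
    braidShadow⇔supp⇔ bs = mk⇔ shadow⇒supp⇔ (supp⇔⇒shadow bs)

  length≡1⇒¬inBsClass : ∀ {α q} → length α ≡ 1 → ¬ InBsClass M α q
  length≡1⇒¬inBsClass |α|≡1 bs with ≤-trans (inBsClass⇒≤length bs) (≤-reflexive |α|≡1)
  ... | s≤s ()

  link⇒oddShadows : ∀ {α} → IsLink M α → ∀ β → InBraidClass M α β → OddShadows β
  link⇒oddShadows (_ , _ , inj₁ |α|≡1) β αβ q sh = ⊥-elim (length≡1⇒¬inBsClass |α|≡1 (β , αβ , sh))
  link⇒oddShadows (_ , _ , inj₂ (_ , bs⇔)) β αβ q sh with Equivalence.to (bs⇔ q) (β , αβ , sh)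
  ... | c , q≡ , _ = c , q≡

  link⇒inBsClass : ∀ {α r j} → IsLink M α → Rank M α r → j < r → InBsClass M α (suc (2 * j))
  link⇒inBsClass (_ , _ , inj₁ |α|≡1) rank j<r =
    contradiction (≤-trans j<r (hasCard-≤ [] rank (⊥-elim ∘ length≡1⇒¬inBsClass |α|≡1))) λ ()
  link⇒inBsClass {α} {r} {j} (_ , _ , inj₂ ((k , |α|≡) , bs⇔)) rank j<r =
    Equivalence.from (bs⇔ _) (j , refl , subst (3 + 2 * j ≤_) (sym |α|≡) (Equivalence.from 3+2c≤1+2k⇔c<k j<k))
    where
    r≤k : r ≤ k
    r≤k = subst (r ≤_) (length-applyUpTo _ k) (hasCard-≤ (applyUpTo (λ c → suc (2 * c)) k) rank odd∈)
      where
      odd∈ : ∀ {q} → InBsClass M α q → q ∈ applyUpTo (λ c → suc (2 * c)) k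
      odd∈ bs with Equivalence.to (bs⇔ _) bs
      ... | c , refl , 3+2c≤ = ∈-applyUpTo⁺ (λ c → suc (2 * c)) {c}
        (Equivalence.to 3+2c≤1+2k⇔c<k (subst (3 + 2 * c ≤_) |α|≡ 3+2c≤))
    j<k : j < k
    j<k = ≤-trans j<r r≤k

proposition3p15 : ∀ {n} (M : CoxeterMatrix n) → SimplyLaced M → TriangleFree M →
    (α : Word n) (r : ℕ) → IsLink M α → Rank M α r → 1 ≤ r →
    (i : ℕ) → 1 ≤ i → i ≤ r →
    BraidShadow M α (2 * i ∸ 1) ⇔
      (∀ (s : Fin n) → Supp α (2 * i ∸ 1) (suc (2 * i)) s ⇔ SuppClass M α (2 * i) (2 * i) s)
proposition3p15 M _ tf α r link rank _ zero    () _
-- 2 * suc j ∸ 1 normalises to j + suc (j + 0).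
proposition3p15 M _ tf α r link rank _ (suc j) _  j<r rewrite +-suc j (j + 0) =
  braidShadow⇔supp⇔ M tf (link⇒oddShadows M link) j (link⇒inBsClass M link rank j<r)
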